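{- Let $r>s\ge 2$ be integers, let $\rho=r/\gcd\{r,s\}$ and $\sigma=s/\gcd\{r,s\}$, and suppose that $\rho$ divides $s-1$. Then no bipartite biregular graph with degrees $r,s$ and diameter $3$ has order equal to $M(r,s;3)=\left\lfloor\frac{1+s(r-1)}{\rho}\right\rfloor(\rho+\sigma)$. Instead, every such graph $G=(V_1\cup V_2,E)$ (with vertices of $V_1$ of degree $r$ and vertices of $V_2$ of degree $s$) satisfies $$|V_1|\le [1+s(r-1)-\rho]\frac{\sigma}{\rho},\qquad |V_2|\le 1+s(r-1)-\rho,$$ so its order is at most $M^*(r,s;3)=(1+s(r-1)-\rho)\left(1+\frac{\sigma}{\rho}\right)$.
   Context: A bipartite graph $G=(V_1\cup V_2,E)$ with stable sets $V_1,V_2$ is biregular with degrees $r$ and $s$ if every vertex of $V_1$ has degree $r$ and every vertex of $V_2$ has degree $s$. Its order is $|V_1|+|V_2|$. -}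

module Defs where

open import Data.Nat using (ℕ; zero; suc; _+_; _*_; _∸_; _/_; _≤_; ≢-nonZero)
open import Data.Nat.GCD using (gcd; gcd[m,n]≢0)
open import Data.Bool using (Bool; true; false; T)
open import Data.Fin using (Fin)
open import Data.Sum using (_⊎_; inj₁; inj₂)
open import Data.Product using (Σ; _×_; ∃-syntax)
open import Data.Empty using (⊥)
open import Relation.Nullary using (¬_)
open import Relation.Binary.PropositionalEquality using (_≡_)

-- A bipartite graph with stable sets V₁ = Fin n₁ and V₂ = Fin n₂ is given
-- by its (decidable, simple) edge relation between V₁ and V₂.
BipGraph : ℕ → ℕ → Set
BipGraph n₁ n₂ = Fin n₁ → Fin n₂ → Bool

countTrue : ∀ {n} → (Fin n → Bool) → ℕ
countTrue {zero} f = 0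
countTrue {suc n} f with f Fin.zero
... | true  = suc (countTrue (λ i → f (Fin.suc i)))
... | false = countTrue (λ i → f (Fin.suc i))

deg₁ : ∀ {n₁ n₂} → BipGraph n₁ n₂ → Fin n₁ → ℕ
deg₁ E i = countTrue (λ j → E i j)

deg₂ : ∀ {n₁ n₂} → BipGraph n₁ n₂ → Fin n₂ → ℕ
deg₂ E j = countTrue (λ i → E i j)

Biregular : ∀ {n₁ n₂} → BipGraph n₁ n₂ → ℕ → ℕ → Set
Biregular E r s = (∀ i → deg₁ E i ≡ r) × (∀ j → deg₂ E j ≡ s)

Vertex : ℕ → ℕ → Set
Vertex n₁ n₂ = Fin n₁ ⊎ Fin n₂

Adj : ∀ {n₁ n₂} → BipGraph n₁ n₂ → Vertex n₁ n₂ → Vertex n₁ n₂ → Set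
Adj E (inj₁ i) (inj₂ j) = T (E i j)
Adj E (inj₂ j) (inj₁ i) = T (E i j)
Adj E (inj₁ _) (inj₁ _) = ⊥
Adj E (inj₂ _) (inj₂ _) = ⊥

data Walk {n₁ n₂} (E : BipGraph n₁ n₂) : Vertex n₁ n₂ → Vertex n₁ n₂ → ℕ → Set where
  here : ∀ {u} → Walk E u u 0
  step : ∀ {u v w k} → Adj E u v → Walk E v w k → Walk E u w (suc k)

DistLE : ∀ {n₁ n₂} → BipGraph n₁ n₂ → Vertex n₁ n₂ → Vertex n₁ n₂ → ℕ → Set
DistLE E u v k = ∃[ l ] (l ≤ k × Walk E u v l)

HasDiameter : ∀ {n₁ n₂} → BipGraph n₁ n₂ → ℕ → Set
HasDiameter E zero = ∀ u v → DistLE E u v 0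
HasDiameter E (suc d) =
  (∀ u v → DistLE E u v (suc d)) × (∃[ u ] ∃[ v ] ¬ DistLE E u v d)

ρ : ℕ → ℕ → ℕ
ρ zero s = 0
ρ (suc r) s = _/_ (suc r) (gcd (suc r) s)
  {{≢-nonZero (gcd[m,n]≢0 (suc r) s (inj₁ (λ ())))}}

σ : ℕ → ℕ → ℕ
σ zero s = 0
σ (suc r) s = _/_ s (gcd (suc r) s)
  {{≢-nonZero (gcd[m,n]≢0 (suc r) s (inj₁ (λ ())))}}

-- M(r,s;3) = ⌊(1 + s(r-1)) / ρ⌋ (ρ + σ)
M3 : ℕ → ℕ → ℕ
M3 zero s = 0
M3 (suc r) s with ρ (suc r) s
... | zero   = 0
... | suc p  = ((1 + s * r) / suc p) * (suc p + σ (suc r) s)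

-- Fix v ∈ V₂ and write c(v,w) for the number of common neighbours of v, w ∈ V₂.
-- Summing c(v,w) over w ∈ V₂ counts the paths of length 2 from v, so it is rs,
-- and c(v,v) = s. Diameter 3 forces c(v,w) ≥ 1 for w ≠ v, whence
-- |V₂| ≤ N := 1 + s(r - 1). If equality held, every such c(v,w) would be exactly 1,
-- so no two vertices of V₁ share two neighbours, and the same count from the
-- side of V₁ gives |V₁| ≥ 1 + r(s - 1); together with |V₁| r = |V₂| s this
-- contradicts r > s ≥ 2. Now |V₁| ρ = |V₂| σ with ρ, σ coprime, so ρ divides
-- |V₂|, and ρ divides N because it divides r and s - 1. Hence |V₂| ≤ N - ρ,
-- which gives the bounds, while order (N/ρ)(ρ + σ) would force |V₂| = N.

module Submission where

open import Defs
open import Data.Nat using (ℕ; zero; suc; _+_; _*_; _∸_; _/_; _≤_; _<_; z≤n; s≤s; z<s; NonZero; ≢-nonZero; >-nonZero; >-nonZero⁻¹)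
open import Data.Nat.Properties hiding (_≟_)
open import Data.Nat.Divisibility using (_∣_; divides; ∣m+n∣m⇒∣n; ∣m⇒∣m*n)
open import Data.Nat.DivMod using (m/n*n≡m)
open import Data.Nat.GCD using (gcd; gcd[m,n]≢0; gcd[m,n]∣m; gcd[m,n]∣n)
open import Data.Nat.Coprimality using (coprime-/gcd; coprime-divisor)
open import Data.Nat.Tactic.RingSolver using (solve-∀)
open import Algebra.Properties.Semiring.Sum +-*-semiring
  using (sum; sum-syntax; sum-remove; sum-cong-≗; ∑-comm; *-distribˡ-sum; *-distribʳ-sum)
open import Data.Bool using (Bool; true; false; T; _∧_)
open import Data.Bool.Properties using (∧-idem)
open import Data.Fin using (Fin; zero; suc; punchIn; punchOut)
open import Data.Fin.Properties using (punchInᵢ≢i; punchIn-punchOut; _≟_)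
  renaming (0≢1+n to 0≢1+ᶠn; suc-injective to suc-injectiveᶠ)
open import Data.Vec.Functional using (Vector; tail; removeAt)
open import Data.Sum using (_⊎_; inj₁; inj₂)
open import Data.Product using (_×_; _,_; ∃-syntax; proj₂; swap; map₁)
open import Function using (_∘_)
open import Relation.Nullary using (¬_; yes; no; contradiction)
open import Relation.Binary.PropositionalEquality

∑-const : ∀ n x → ∑[ i < n ] x ≡ n * x
∑-const zero    x = refl
∑-const (suc n) x = cong (x +_) (∑-const n x)

n≤∑ : ∀ {n} (t : Vector ℕ n) → (∀ i → 1 ≤ t i) → n ≤ sum t
n≤∑ {zero}  t 1≤t = z≤n
n≤∑ {suc n} t 1≤t = +-mono-≤ (1≤t zero) (n≤∑ (tail t) (1≤t ∘ suc))

∑≤n : ∀ {n} (t : Vector ℕ n) → (∀ i → t i ≤ 1) → sum t ≤ n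
∑≤n {zero}  t t≤1 = z≤n
∑≤n {suc n} t t≤1 = +-mono-≤ (t≤1 zero) (∑≤n (tail t) (t≤1 ∘ suc))

lookup≤∑ : ∀ {n} (t : Vector ℕ n) i → t i ≤ sum t
lookup≤∑ t zero    = m≤m+n (t zero) _
lookup≤∑ t (suc i) = ≤-trans (lookup≤∑ (tail t) i) (m≤n+m _ (t zero))

lookup+lookup≤∑ : ∀ {n} (t : Vector ℕ n) {i j} → i ≢ j → t i + t j ≤ sum t
lookup+lookup≤∑ {suc n} t {i} {j} i≢j = begin
  t i + t j                              ≡⟨ cong (λ k → t i + t k) (punchIn-punchOut i≢j) ⟨
  t i + removeAt t i (punchOut i≢j)      ≤⟨ +-monoʳ-≤ (t i) (lookup≤∑ (removeAt t i) _) ⟩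
  t i + sum (removeAt t i)               ≡⟨ sum-remove t ⟨
  sum t                                  ∎
  where open ≤-Reasoning

∑≤n⇒≤1 : ∀ {n} (t : Vector ℕ n) → (∀ i → 1 ≤ t i) → sum t ≤ n → ∀ i → t i ≤ 1
∑≤n⇒≤1 {suc n} t 1≤t ∑t≤n i = +-cancelʳ-≤ n (t i) 1 (begin
  t i + n                   ≤⟨ +-monoʳ-≤ (t i) (n≤∑ (removeAt t i) (1≤t ∘ punchIn i)) ⟩
  t i + sum (removeAt t i)  ≡⟨ sum-remove t ⟨
  sum t                     ≤⟨ ∑t≤n ⟩
  suc n                     ∎)
  where open ≤-Reasoning

toℕ : Bool → ℕ
toℕ true  = 1
toℕ false = 0

toℕ-∧ : ∀ x y → toℕ (x ∧ y) ≡ toℕ x * toℕ y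
toℕ-∧ true  y = sym (+-identityʳ (toℕ y))
toℕ-∧ false y = refl

T⇒1≤toℕ : ∀ {b} → T b → 1 ≤ toℕ b
T⇒1≤toℕ {true} _ = ≤-refl

∧-split : ∀ x {y} → T (x ∧ y) → T x × T y
∧-split true t = _ , t

∧-join : ∀ x {y} → T x → T y → T (x ∧ y)
∧-join true _ t = t

countTrue≡∑ : ∀ {n} (f : Fin n → Bool) → countTrue f ≡ ∑[ i < n ] toℕ (f i)
countTrue≡∑ {zero}  f = refl
countTrue≡∑ {suc n} f with f zero
... | true  = cong suc (countTrue≡∑ (f ∘ suc))
... | false = countTrue≡∑ (f ∘ suc)

countTrue-cong : ∀ {n} {f g : Fin n → Bool} → (∀ i → f i ≡ g i) → countTrue f ≡ countTrue g
countTrue-cong {f = f} {g} f≗g = begin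
  countTrue f             ≡⟨ countTrue≡∑ f ⟩
  sum (toℕ ∘ f)           ≡⟨ sum-cong-≗ (cong toℕ ∘ f≗g) ⟩
  sum (toℕ ∘ g)           ≡⟨ countTrue≡∑ g ⟨
  countTrue g             ∎
  where open ≡-Reasoning

1≤countTrue : ∀ {n} (f : Fin n → Bool) {i} → T (f i) → 1 ≤ countTrue f
1≤countTrue f {i} fi = begin
  1                 ≤⟨ T⇒1≤toℕ fi ⟩
  toℕ (f i)         ≤⟨ lookup≤∑ (toℕ ∘ f) i ⟩
  sum (toℕ ∘ f)     ≡⟨ countTrue≡∑ f ⟨
  countTrue f       ∎
  where open ≤-Reasoning

2≤countTrue : ∀ {n} (f : Fin n → Bool) {i j} → T (f i) → T (f j) → i ≢ j → 2 ≤ countTrue f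
2≤countTrue f {i} {j} fi fj i≢j = begin
  2                       ≤⟨ +-mono-≤ (T⇒1≤toℕ fi) (T⇒1≤toℕ fj) ⟩
  toℕ (f i) + toℕ (f j)   ≤⟨ lookup+lookup≤∑ (toℕ ∘ f) i≢j ⟩
  sum (toℕ ∘ f)           ≡⟨ countTrue≡∑ f ⟨
  countTrue f             ∎
  where open ≤-Reasoning

countTrue≡0 : ∀ {n} (f : Fin n → Bool) → (∀ i → ¬ T (f i)) → countTrue f ≡ 0
countTrue≡0 {zero}  f none = refl
countTrue≡0 {suc n} f none with f zero in eq
... | true  = contradiction (subst T (sym eq) _) (none zero)
... | false = countTrue≡0 (f ∘ suc) (none ∘ suc)

countTrue≤1 : ∀ {n} (f : Fin n → Bool) → (∀ i j → T (f i) → T (f j) → i ≡ j) → countTrue f ≤ 1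
countTrue≤1 {zero}  f unique = z≤n
countTrue≤1 {suc n} f unique with f zero in eq
... | true  = s≤s (≤-reflexive (countTrue≡0 (f ∘ suc) (λ i fi →
                0≢1+ᶠn (unique zero (suc i) (subst T (sym eq) _) fi))))
... | false = countTrue≤1 (f ∘ suc) (λ i j fi fj → suc-injectiveᶠ (unique (suc i) (suc j) fi fj))

transpose : ∀ {n₁ n₂} → BipGraph n₁ n₂ → BipGraph n₂ n₁
transpose E j i = E i j

codegree : ∀ {n₁ n₂} → BipGraph n₁ n₂ → Fin n₂ → Fin n₂ → ℕ
codegree E v w = countTrue (λ i → E i v ∧ E i w)

Covering : ∀ {n₁ n₂} → BipGraph n₁ n₂ → Set
Covering E = ∀ v w → w ≢ v → 1 ≤ codegree E v w

Packing : ∀ {n₁ n₂} → BipGraph n₁ n₂ → Set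
Packing E = ∀ v w → w ≢ v → codegree E v w ≤ 1

module _ {n₁ n₂} (E : BipGraph n₁ n₂) where

  codegree-self : ∀ v → codegree E v v ≡ deg₂ E v
  codegree-self v = countTrue-cong (λ i → ∧-idem (E i v))

  handshake : ∀ {r s} → Biregular E r s → n₁ * r ≡ n₂ * s
  handshake {r} {s} (reg₁ , reg₂) = begin
    n₁ * r                                  ≡⟨ ∑-const n₁ r ⟨
    ∑[ i < n₁ ] r                           ≡⟨ sum-cong-≗ (λ i → trans (sym (reg₁ i)) (countTrue≡∑ (E i))) ⟩
    ∑[ i < n₁ ] ∑[ j < n₂ ] toℕ (E i j)     ≡⟨ ∑-comm (λ i j → toℕ (E i j)) ⟩
    ∑[ j < n₂ ] ∑[ i < n₁ ] toℕ (E i j)     ≡⟨ sum-cong-≗ (λ j → trans (sym (countTrue≡∑ (λ i → E i j))) (reg₂ j)) ⟩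
    ∑[ j < n₂ ] s                           ≡⟨ ∑-const n₂ s ⟩
    n₂ * s                                  ∎
    where open ≡-Reasoning

  ∑-codegree : ∀ {r s} → Biregular E r s → ∀ v → ∑[ w < n₂ ] codegree E v w ≡ s * r
  ∑-codegree {r} {s} (reg₁ , reg₂) v = begin
    ∑[ w < n₂ ] codegree E v w                                ≡⟨ sum-cong-≗ (λ w → countTrue≡∑ (λ i → E i v ∧ E i w)) ⟩
    ∑[ w < n₂ ] ∑[ i < n₁ ] toℕ (E i v ∧ E i w)               ≡⟨ sum-cong-≗ (λ w → sum-cong-≗ (λ i → toℕ-∧ (E i v) (E i w))) ⟩
    ∑[ w < n₂ ] ∑[ i < n₁ ] (toℕ (E i v) * toℕ (E i w))       ≡⟨ ∑-comm (λ w i → toℕ (E i v) * toℕ (E i w)) ⟩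
    ∑[ i < n₁ ] ∑[ w < n₂ ] (toℕ (E i v) * toℕ (E i w))       ≡⟨ sum-cong-≗ (λ i → *-distribˡ-sum (toℕ (E i v)) (toℕ ∘ E i)) ⟨
    ∑[ i < n₁ ] (toℕ (E i v) * ∑[ w < n₂ ] toℕ (E i w))       ≡⟨ sum-cong-≗ (λ i → cong (toℕ (E i v) *_) (trans (sym (countTrue≡∑ (E i))) (reg₁ i))) ⟩
    ∑[ i < n₁ ] (toℕ (E i v) * r)                             ≡⟨ *-distribʳ-sum r (λ i → toℕ (E i v)) ⟨
    (∑[ i < n₁ ] toℕ (E i v)) * r                             ≡⟨ cong (_* r) (trans (sym (countTrue≡∑ (λ i → E i v))) (reg₂ v)) ⟩
    s * r                                                     ∎
    where open ≡-Reasoning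

  same-side-walk : ∀ {v w l} → l ≤ 3 → Walk E (inj₂ v) (inj₂ w) l →
                   v ≡ w ⊎ ∃[ i ] (T (E i v) × T (E i w))
  same-side-walk _ here = inj₁ refl
  same-side-walk _ (step {v = inj₂ _} () _)
  same-side-walk _ (step {v = inj₁ _} _ (step {v = inj₁ _} () _))
  same-side-walk _ (step {v = inj₁ i} iv (step {v = inj₂ _} iw here)) = inj₂ (i , iv , iw)
  same-side-walk _ (step {v = inj₁ _} _ (step {v = inj₂ _} _ (step {v = inj₂ _} () _)))
  same-side-walk (s≤s (s≤s (s≤s ()))) (step {v = inj₁ _} _ (step {v = inj₂ _} _ (step {v = inj₁ _} _ (step _ _))))

  diameter≤3⇒covering : (∀ u v → DistLE E u v 3) → Covering E
  diameter≤3⇒covering diam v w w≢v with diam (inj₂ v) (inj₂ w)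
  ... | l , l≤3 , walk with same-side-walk l≤3 walk
  ...   | inj₁ v≡w             = contradiction (sym v≡w) w≢v
  ...   | inj₂ (i , iv , iw)   = 1≤countTrue (λ k → E k v ∧ E k w) (∧-join (E i v) iv iw)

  packing⇒packing-transpose : Packing E → Packing (transpose E)
  packing⇒packing-transpose packing i j j≢i = countTrue≤1 (λ w → E i w ∧ E j w) unique
    where
    unique : ∀ w w′ → T (E i w ∧ E j w) → T (E i w′ ∧ E j w′) → w ≡ w′
    unique w w′ ij~w ij~w′ with w ≟ w′ | ∧-split (E i w) ij~w | ∧-split (E i w′) ij~w′
    ... | yes w≡w′ | _         | _           = w≡w′
    ... | no w≢w′  | iw , jw   | iw′ , jw′   = contradiction (packing w w′ (w≢w′ ∘ sym))
      (<⇒≱ (2≤countTrue (λ k → E k w ∧ E k w′) (∧-join (E i w) iw iw′) (∧-join (E j w) jw jw′) (j≢i ∘ sym)))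

module _ {n₁ m} (E : BipGraph n₁ (suc m)) {r s} (reg : Biregular E r s) where

  ∑-codegree-others : ∀ v → sum (removeAt (codegree E v) v) ≡ s * (r ∸ 1)
  ∑-codegree-others v = begin
    others                                  ≡⟨ m+n∸m≡n s others ⟨
    s + others ∸ s                          ≡⟨ cong (λ d → d + others ∸ s) (trans (codegree-self E v) (proj₂ reg v)) ⟨
    codegree E v v + others ∸ s             ≡⟨ cong (_∸ s) (sum-remove (codegree E v)) ⟨
    sum (codegree E v) ∸ s                  ≡⟨ cong (_∸ s) (∑-codegree E reg v) ⟩
    s * r ∸ s                               ≡⟨ cong (s * r ∸_) (*-identityʳ s) ⟨
    s * r ∸ s * 1                           ≡⟨ *-distribˡ-∸ s r 1 ⟨
    s * (r ∸ 1)                             ∎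
    where
    open ≡-Reasoning
    others : ℕ
    others = sum (removeAt (codegree E v) v)

  covering⇒m≤s*[r∸1] : Covering E → m ≤ s * (r ∸ 1)
  covering⇒m≤s*[r∸1] covering =
    subst (m ≤_) (∑-codegree-others zero) (n≤∑ _ λ j → covering zero (punchIn zero j) (punchInᵢ≢i zero j))

  packing⇒s*[r∸1]≤m : Packing E → s * (r ∸ 1) ≤ m
  packing⇒s*[r∸1]≤m packing =
    subst (_≤ m) (∑-codegree-others zero) (∑≤n _ λ j → packing zero (punchIn zero j) (punchInᵢ≢i zero j))

  tight-covering⇒packing : Covering E → m ≡ s * (r ∸ 1) → Packing E
  tight-covering⇒packing covering m≡ v w w≢v = subst (λ u → codegree E v u ≤ 1) (punchIn-punchOut (w≢v ∘ sym))
    (∑≤n⇒≤1 (removeAt (codegree E v) v) (λ j → covering v (punchIn v j) (punchInᵢ≢i v j))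
      (≤-reflexive (trans (∑-codegree-others v) (sym m≡))) (punchOut (w≢v ∘ sym)))

covering⇒n₂≤1+s*[r∸1] : ∀ {n₁ n₂} (E : BipGraph n₁ n₂) {r s} → Biregular E r s → Covering E →
                          n₂ ≤ 1 + s * (r ∸ 1)
covering⇒n₂≤1+s*[r∸1] {n₂ = zero}  E reg covering = z≤n
covering⇒n₂≤1+s*[r∸1] {n₂ = suc m} E reg covering = s≤s (covering⇒m≤s*[r∸1] E reg covering)

-- The difference of the two sides is (r - s)(r - 1)(s - 1).
moore-product-< : ∀ {r s} → 2 ≤ s → s < r → (1 + s * (r ∸ 1)) * s < (1 + r * (s ∸ 1)) * r
moore-product-< {r} {s@(suc (suc b))} (s≤s (s≤s z≤n)) s<r =
  subst (λ r → (1 + s * (r ∸ 1)) * s < (1 + r * (s ∸ 1)) * r) (m+[n∸m]≡n s<r)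
    (subst ((1 + s * (s + k)) * s <_) (gap b k) (m<m+n ((1 + s * (s + k)) * s) z<s))
  where
  k : ℕ
  k = r ∸ suc s
  gap : ∀ b k → (1 + (2 + b) * (2 + b + k)) * (2 + b) + (1 + k) * ((1 + b) * (2 + b + k))
              ≡ (1 + (3 + b + k) * (1 + b)) * (3 + b + k)
  gap = solve-∀

moore-bound-not-attained : ∀ {n₁ n₂} (E : BipGraph n₁ n₂) {r s} → 2 ≤ s → s < r →
                           Biregular E r s → Covering E → n₂ ≢ 1 + s * (r ∸ 1)
moore-bound-not-attained {zero} {suc m} E (s≤s (s≤s z≤n)) _ reg _ _ = contradiction (handshake E reg) λ ()
moore-bound-not-attained {suc m₁} {suc m} E {r} {s} 2≤s s<r reg covering n₂≡ =
  <⇒≱ (moore-product-< 2≤s s<r) (begin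
    (1 + r * (s ∸ 1)) * r   ≤⟨ *-monoˡ-≤ r (s≤s n₁-bound) ⟩
    suc m₁ * r              ≡⟨ handshake E reg ⟩
    suc m * s               ≡⟨ cong (_* s) n₂≡ ⟩
    (1 + s * (r ∸ 1)) * s   ∎)
  where
  open ≤-Reasoning
  packing : Packing (transpose E)
  packing = packing⇒packing-transpose E (tight-covering⇒packing E reg covering (suc-injective n₂≡))
  n₁-bound : r * (s ∸ 1) ≤ m₁
  n₁-bound = packing⇒s*[r∸1]≤m (transpose E) (swap reg) packing

next-multiple-≤ : ∀ {d m n} → d ∣ m → d ∣ n → m < n → m + d ≤ n
next-multiple-≤ {d} (divides x refl) (divides y refl) xd<yd =
  subst (_≤ y * d) (+-comm d (x * d)) (*-monoˡ-≤ d (*-cancelʳ-< _ x y xd<yd))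

r*s≡[s∸1]+[1+s*[r∸1]] : ∀ a s → 1 ≤ s → suc a * s ≡ s ∸ 1 + (1 + s * a)
r*s≡[s∸1]+[1+s*[r∸1]] a (suc b) _ = identity a b
  where
  identity : ∀ a b → suc a * suc b ≡ b + (1 + suc b * a)
  identity = solve-∀

-- Here r is suc a, so r ∸ 1 is a.
module _ (a s : ℕ) where

  private
    g : ℕ
    g = gcd (suc a) s
    instance
      g≢0 : NonZero g
      g≢0 = ≢-nonZero (gcd[m,n]≢0 (suc a) s (inj₁ λ ()))

  ρ*gcd≡r : ρ (suc a) s * g ≡ suc a
  ρ*gcd≡r = m/n*n≡m (gcd[m,n]∣m (suc a) s)

  σ*gcd≡s : σ (suc a) s * g ≡ s
  σ*gcd≡s = m/n*n≡m (gcd[m,n]∣n (suc a) s)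

  ρ≢0 : NonZero (ρ (suc a) s)
  ρ≢0 = m*n≢0⇒m≢0 (ρ (suc a) s) {{subst NonZero (sym ρ*gcd≡r) _}}

  ρ∣r : ρ (suc a) s ∣ suc a
  ρ∣r = divides g (trans (sym ρ*gcd≡r) (*-comm (ρ (suc a) s) g))

  handshake-ρσ : ∀ {n₁ n₂} → n₁ * suc a ≡ n₂ * s → n₁ * ρ (suc a) s ≡ n₂ * σ (suc a) s
  handshake-ρσ {n₁} {n₂} n₁r≡n₂s = *-cancelʳ-≡ _ _ g (begin
    n₁ * ρ (suc a) s * g        ≡⟨ *-assoc n₁ _ g ⟩
    n₁ * (ρ (suc a) s * g)      ≡⟨ cong (n₁ *_) ρ*gcd≡r ⟩
    n₁ * suc a                  ≡⟨ n₁r≡n₂s ⟩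
    n₂ * s                      ≡⟨ cong (n₂ *_) σ*gcd≡s ⟨
    n₂ * (σ (suc a) s * g)      ≡⟨ *-assoc n₂ _ g ⟨
    n₂ * σ (suc a) s * g        ∎)
    where open ≡-Reasoning

  ρ∣n₂ : ∀ {n₁ n₂} → n₁ * ρ (suc a) s ≡ n₂ * σ (suc a) s → ρ (suc a) s ∣ n₂
  ρ∣n₂ {n₁} {n₂} n₁ρ≡n₂σ =
    coprime-divisor (coprime-/gcd (suc a) s) (divides n₁ (trans (*-comm _ n₂) (sym n₁ρ≡n₂σ)))

  ρ∣1+s*[r∸1] : 1 ≤ s → ρ (suc a) s ∣ s ∸ 1 → ρ (suc a) s ∣ 1 + s * a
  ρ∣1+s*[r∸1] 1≤s ρ∣s∸1 =
    ∣m+n∣m⇒∣n (subst (ρ (suc a) s ∣_) (r*s≡[s∸1]+[1+s*[r∸1]] a s 1≤s) (∣m⇒∣m*n s ρ∣r)) ρ∣s∸1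

  M3≡ : M3 (suc a) s ≡ _/_ (1 + s * a) (ρ (suc a) s) {{ρ≢0}} * (ρ (suc a) s + σ (suc a) s)
  M3≡ with ρ (suc a) s | ρ≢0
  ... | suc p | _ = refl

order-bounds : ∀ {P Q N n₁ n₂} .{{_ : NonZero P}} → n₁ * P ≡ n₂ * Q → P ∣ n₂ → P ∣ N → n₂ < N →
               (n₁ + n₂ ≢ N / P * (P + Q))
               × (n₁ * P ≤ (N ∸ P) * Q)
               × (n₂ ≤ N ∸ P)
               × ((n₁ + n₂) * P ≤ (N ∸ P) * (P + Q))
order-bounds {P} {Q} {N} {n₁} {n₂} n₁P≡n₂Q P∣n₂ P∣N n₂<N = order≢ , V₁-bound , V₂-bound , order-bound
  where
  open ≡-Reasoning

  order*P≡n₂*[P+Q] : (n₁ + n₂) * P ≡ n₂ * (P + Q)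
  order*P≡n₂*[P+Q] = begin
    (n₁ + n₂) * P      ≡⟨ *-distribʳ-+ P n₁ n₂ ⟩
    n₁ * P + n₂ * P    ≡⟨ cong (_+ n₂ * P) n₁P≡n₂Q ⟩
    n₂ * Q + n₂ * P    ≡⟨ +-comm (n₂ * Q) (n₂ * P) ⟩
    n₂ * P + n₂ * Q    ≡⟨ *-distribˡ-+ n₂ P Q ⟨
    n₂ * (P + Q)       ∎

  V₂-bound : n₂ ≤ N ∸ P
  V₂-bound = m+n≤o⇒m≤o∸n n₂ (next-multiple-≤ P∣n₂ P∣N n₂<N)

  V₁-bound : n₁ * P ≤ (N ∸ P) * Q
  V₁-bound = subst (_≤ (N ∸ P) * Q) (sym n₁P≡n₂Q) (*-monoˡ-≤ Q V₂-bound)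

  order-bound : (n₁ + n₂) * P ≤ (N ∸ P) * (P + Q)
  order-bound = subst (_≤ (N ∸ P) * (P + Q)) (sym order*P≡n₂*[P+Q]) (*-monoˡ-≤ (P + Q) V₂-bound)

  instance
    P+Q≢0 : NonZero (P + Q)
    P+Q≢0 = >-nonZero (≤-trans (>-nonZero⁻¹ P) (m≤m+n P Q))

  order≢ : n₁ + n₂ ≢ N / P * (P + Q)
  order≢ order≡ = <-irrefl n₂*[P+Q]≡N*[P+Q] (*-monoˡ-< (P + Q) n₂<N)
    where
    n₂*[P+Q]≡N*[P+Q] : n₂ * (P + Q) ≡ N * (P + Q)
    n₂*[P+Q]≡N*[P+Q] = begin
      n₂ * (P + Q)             ≡⟨ order*P≡n₂*[P+Q] ⟨
      (n₁ + n₂) * P            ≡⟨ cong (_* P) order≡ ⟩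
      N / P * (P + Q) * P      ≡⟨ *-assoc (N / P) (P + Q) P ⟩
      N / P * ((P + Q) * P)    ≡⟨ cong (N / P *_) (*-comm (P + Q) P) ⟩
      N / P * (P * (P + Q))    ≡⟨ *-assoc (N / P) P (P + Q) ⟨
      N / P * P * (P + Q)      ≡⟨ cong (_* (P + Q)) (m/n*n≡m P∣N) ⟩
      N * (P + Q)              ∎

proposition2p2 : (r s : ℕ) → 2 ≤ s → s < r → ρ r s ∣ (s ∸ 1) →
    ∀ {n₁ n₂} (E : BipGraph n₁ n₂) → Biregular E r s → HasDiameter E 3 →
      (n₁ + n₂ ≢ M3 r s)
      × (n₁ * ρ r s ≤ (1 + s * (r ∸ 1) ∸ ρ r s) * σ r s)
      × (n₂ ≤ 1 + s * (r ∸ 1) ∸ ρ r s)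
      × ((n₁ + n₂) * ρ r s ≤ (1 + s * (r ∸ 1) ∸ ρ r s) * (ρ r s + σ r s))
proposition2p2 zero    s _   ()  _     _ _ _
proposition2p2 (suc a) s 2≤s s<r ρ∣s∸1 {n₁} {n₂} E reg (diam , _) =
  map₁ (λ ≢N/ρ*[ρ+σ] ≡M3 → ≢N/ρ*[ρ+σ] (trans ≡M3 (M3≡ a s)))
    (order-bounds {{ρ≢0 a s}} n₁ρ≡n₂σ (ρ∣n₂ a s {n₁} n₁ρ≡n₂σ) (ρ∣1+s*[r∸1] a s (≤-trans (s≤s z≤n) 2≤s) ρ∣s∸1) n₂<N)
  where
  covering : Covering E
  covering = diameter≤3⇒covering E diam

  n₁ρ≡n₂σ : n₁ * ρ (suc a) s ≡ n₂ * σ (suc a) s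
  n₁ρ≡n₂σ = handshake-ρσ a s {n₁} {n₂} (handshake E reg)

  n₂<N : n₂ < 1 + s * a
  n₂<N = ≤∧≢⇒< (covering⇒n₂≤1+s*[r∸1] E reg covering) (moore-bound-not-attained E 2≤s s<r reg covering)
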